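{- Let $\Sigma$ be a finite nonempty closed set of $k$-faces of $\mathbb{Z}^d$ ($1\le k\le d$). Then both the lexicographically smallest and the lexicographically largest element $f$ of $\Sigma$ (ordering faces by their centers) satisfy $1\in\mathrm{Int}(\bm f)$, i.e. the first coordinate of the center $\bm f$ is an integer.
   Context: A $k$-face of $\mathbb{Z}^d$ is a set $\{x\in\mathbb{R}^d:|x_i-b_i|\le\frac12\ (i\in H),\ x_i=b_i\ (i\notin H)\}$ with $|H|=k$, where the center $b$ has $b_i\in\mathbb{Z}+\frac12$ for $i\in H$ and $b_i\in\mathbb{Z}$ otherwise; $\mathrm{Int}(b)=\{1,\dots,d\}\setminus H$. Lexicographic order on centers compares the first coordinate, then the second, etc. $\Sigma$ is closed if every $(k-1)$-face contained in an element of $\Sigma$ is contained in at least one other element of $\Sigma$ (no face of $\Sigma$ is part of a boundary). -}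

module Defs where

open import Data.Nat as ℕ using (ℕ; zero; suc; _%_)
open import Data.Integer as ℤ using (ℤ; +_; ∣_∣)
open import Data.Fin using (Fin; zero; suc; _<_)
open import Data.Vec using (Vec; []; _∷_; lookup)
open import Data.List using (List)
open import Data.List.Membership.Propositional using (_∈_)
open import Data.Product using (Σ; ∃; _×_; _,_)
open import Data.Sum using (_⊎_)
open import Relation.Binary.PropositionalEquality using (_≡_; _≢_)

-- Encoding convention: the center b ∈ ((1/2)ℤ)^d of a face is represented by
-- its DOUBLED coordinates c = 2b ∈ ℤ^d.  Then b_i ∈ ℤ + 1/2 (i ∈ H) iff c_i is
-- odd, and b_i ∈ ℤ (i ∈ Int(b)) iff c_i is even.  Every c ∈ ℤ^d is the center
-- of exactly one face, of dimension (number of odd coordinates).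
Center : ℕ → Set
Center d = Vec ℤ d

Odd : ℤ → Set
Odd x = ∣ x ∣ % 2 ≡ 1

Even : ℤ → Set
Even x = ∣ x ∣ % 2 ≡ 0

dimFace : ∀ {d} → Center d → ℕ
dimFace [] = 0
dimFace (x ∷ xs) with ∣ x ∣ % 2
... | 1 = suc (dimFace xs)
... | _ = dimFace xs

IsFace : ∀ {d} → ℕ → Center d → Set
IsFace k c = dimFace c ≡ k

-- Set-theoretic inclusion of faces (as closed boxes), written coordinatewise:
-- the face with center g/2 is contained in the face with center f/2 iff for
-- every i, the i-th projection of g (a point g_i/2 or the interval
-- [g_i/2 - 1/2, g_i/2 + 1/2]) lies in that of f: either the two coincide, or
-- f is an interval in direction i (f_i odd) and g is one of its endpoints
-- (g_i = f_i ± 1).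
_⊆F_ : ∀ {d} → Center d → Center d → Set
g ⊆F f = ∀ i → lookup g i ≡ lookup f i
               ⊎ (Odd (lookup f i) × (lookup g i ≡ lookup f i ℤ.+ + 1
                                     ⊎ lookup g i ≡ lookup f i ℤ.- + 1))

Closed : ∀ {d} → ℕ → List (Center d) → Set
Closed {d} k S = ∀ (f : Center d) → f ∈ S →
  ∀ (g : Center d) → IsFace (k ℕ.∸ 1) g → g ⊆F f →
  ∃ λ f' → f' ∈ S × f' ≢ f × g ⊆F f'

-- strict lexicographic order on centers (doubling preserves the order)
_<lex_ : ∀ {d} → Center d → Center d → Set
_<lex_ {d} a b = ∃ λ (i : Fin d) →
  (∀ (j : Fin d) → j < i → lookup a j ≡ lookup b j) × (lookup a i ℤ.< lookup b i)

_≤lex_ : ∀ {d} → Center d → Center d → Set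
a ≤lex b = a ≡ b ⊎ a <lex b

IsLexMin : ∀ {d} → List (Center d) → Center d → Set
IsLexMin S f = f ∈ S × (∀ f' → f' ∈ S → f ≤lex f')

IsLexMax : ∀ {d} → List (Center d) → Center d → Set
IsLexMax S f = f ∈ S × (∀ f' → f' ∈ S → f' ≤lex f)

{-# OPTIONS --safe #-}
-- If the lexicographically smallest face f = (x, xs) of Σ had x odd, the facet
-- g = (x - 1, xs) of f would, by closedness, lie in a second face f' = (y, ys)
-- of Σ.  As f' is not below f, the only way x - 1 lies in the y-slab is y = x.
-- Then xs ⊆ ys, and both tails have dimension k - 1; a face contained in
-- another is equal to it or of strictly smaller dimension, so f' = f.
-- The largest face is handled the same way with x + 1.
module Submission where

open import Defs
open import Data.Nat as ℕ using (ℕ; suc; _≤_; _+_; _∸_; _%_; s≤s; z≤n)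
import Data.Nat.Properties as ℕ
open import Data.Nat.DivMod using (m%n<n)
open import Data.Integer as ℤ using (ℤ; +_; -[1+_]; ∣_∣; 1ℤ; -1ℤ)
import Data.Integer.Properties as ℤ
open import Algebra.Properties.AbelianGroup ℤ.+-0-abelianGroup using (∙-cancelʳ)
open import Data.Fin as Fin using (zero)
open import Data.Vec using (Vec; []; _∷_; lookup)
open import Data.List using (List; [])
open import Data.List.Membership.Propositional using (_∈_)
open import Data.List.Relation.Unary.All as All using (All)
open import Data.Product using (_×_; ∃₂; _,_)
open import Data.Sum using (_⊎_; inj₁; inj₂)
open import Relation.Nullary using (contradiction)
open import Relation.Binary.PropositionalEquality using (_≡_; _≢_; refl; sym; trans; cong; subst)
open ℕ.≤-Reasoning

parity : ∀ x → Odd x ⊎ Even x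
parity x with ∣ x ∣ % 2 | m%n<n ∣ x ∣ 2
... | 0           | _ = inj₂ refl
... | 1           | _ = inj₁ refl
... | suc (suc _) | s≤s (s≤s ())

n%2≡1⇒[1+n]%2≡0 : ∀ n → n % 2 ≡ 1 → suc n % 2 ≡ 0
n%2≡1⇒[1+n]%2≡0 1               _ = refl
n%2≡1⇒[1+n]%2≡0 (suc (suc n)) odd = n%2≡1⇒[1+n]%2≡0 n odd

[1+n]%2≡1⇒n%2≡0 : ∀ n → suc n % 2 ≡ 1 → n % 2 ≡ 0
[1+n]%2≡1⇒n%2≡0 0               _ = refl
[1+n]%2≡1⇒n%2≡0 (suc (suc n)) odd = [1+n]%2≡1⇒n%2≡0 n odd

odd⇒even[i+1] : ∀ i → Odd i → Even (i ℤ.+ 1ℤ)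
odd⇒even[i+1] (+ m)        odd =
  subst (λ n → n % 2 ≡ 0) (ℕ.+-comm 1 m) (n%2≡1⇒[1+n]%2≡0 m odd)
odd⇒even[i+1] -[1+ 0 ]     _   = refl
odd⇒even[i+1] -[1+ suc m ] odd = n%2≡1⇒[1+n]%2≡0 m odd

odd⇒even[i-1] : ∀ i → Odd i → Even (i ℤ.- 1ℤ)
odd⇒even[i-1] (+ suc m) odd = [1+n]%2≡1⇒n%2≡0 m odd
odd⇒even[i-1] -[1+ m ]  odd =
  subst (λ n → suc (suc n) % 2 ≡ 0) (sym (ℕ.+-identityʳ m)) ([1+n]%2≡1⇒n%2≡0 m odd)

_⊑_ : ℤ → ℤ → Set
a ⊑ b = a ≡ b ⊎ (Odd b × (a ≡ b ℤ.+ + 1 ⊎ a ≡ b ℤ.- + 1))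

⊑⇒≡⊎odd×even : ∀ {a b} → a ⊑ b → a ≡ b ⊎ (Odd b × Even a)
⊑⇒≡⊎odd×even (inj₁ a≡b)                       = inj₁ a≡b
⊑⇒≡⊎odd×even {b = b} (inj₂ (odd , inj₁ refl)) = inj₂ (odd , odd⇒even[i+1] b odd)
⊑⇒≡⊎odd×even {b = b} (inj₂ (odd , inj₂ refl)) = inj₂ (odd , odd⇒even[i-1] b odd)

i-1<i : ∀ i → i ℤ.- 1ℤ ℤ.< i
i-1<i i = ℤ.i≤pred[j]⇒i<j (ℤ.≤-reflexive (ℤ.+-comm i -1ℤ))

i<i+1 : ∀ i → i ℤ.< i ℤ.+ 1ℤ
i<i+1 i = ℤ.suc[i]≤j⇒i<j (ℤ.≤-reflexive (ℤ.+-comm 1ℤ i))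

i-1⊑j∧i≤j⇒i≡j : ∀ {i j} → (i ℤ.- 1ℤ) ⊑ j → i ℤ.≤ j → i ≡ j
i-1⊑j∧i≤j⇒i≡j {i} (inj₁ refl) i≤j = contradiction (i-1<i i) (ℤ.≤⇒≯ i≤j)
i-1⊑j∧i≤j⇒i≡j {i} {j} (inj₂ (_ , inj₁ eq)) i≤j =
  contradiction (ℤ.<-trans (subst (j ℤ.<_) (sym eq) (i<i+1 j)) (i-1<i i)) (ℤ.≤⇒≯ i≤j)
i-1⊑j∧i≤j⇒i≡j {i} {j} (inj₂ (_ , inj₂ eq)) _ = ∙-cancelʳ -1ℤ i j eq

i+1⊑j∧j≤i⇒i≡j : ∀ {i j} → (i ℤ.+ 1ℤ) ⊑ j → j ℤ.≤ i → i ≡ j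
i+1⊑j∧j≤i⇒i≡j {i} (inj₁ refl) j≤i = contradiction (i<i+1 i) (ℤ.≤⇒≯ j≤i)
i+1⊑j∧j≤i⇒i≡j {i} {j} (inj₂ (_ , inj₂ eq)) j≤i =
  contradiction (ℤ.<-trans (i<i+1 i) (subst (ℤ._< j) (sym eq) (i-1<i j))) (ℤ.≤⇒≯ j≤i)
i+1⊑j∧j≤i⇒i≡j {i} {j} (inj₂ (_ , inj₁ eq)) _ = ∙-cancelʳ 1ℤ i j eq

dimFace-∷ : ∀ {n} x (xs : Vec ℤ n) → dimFace (x ∷ xs) ≡ ∣ x ∣ % 2 + dimFace xs
dimFace-∷ x xs with ∣ x ∣ % 2 | m%n<n ∣ x ∣ 2
... | 0           | _ = refl
... | 1           | _ = refl
... | suc (suc _) | s≤s (s≤s ())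

dimFace-∷-cancelˡ : ∀ {n} x {xs ys : Vec ℤ n} →
  dimFace (x ∷ xs) ≡ dimFace (x ∷ ys) → dimFace xs ≡ dimFace ys
dimFace-∷-cancelˡ x {xs} {ys} eq = ℕ.+-cancelˡ-≡ (∣ x ∣ % 2) _ _
  (trans (sym (dimFace-∷ x xs)) (trans eq (dimFace-∷ x ys)))

dimFace-∷-monoʳ-< : ∀ {n} x {xs ys : Vec ℤ n} →
  dimFace xs ℕ.< dimFace ys → dimFace (x ∷ xs) ℕ.< dimFace (x ∷ ys)
dimFace-∷-monoʳ-< x {xs} {ys} lt = begin-strict
  dimFace (x ∷ xs)          ≡⟨ dimFace-∷ x xs ⟩
  ∣ x ∣ % 2 + dimFace xs    <⟨ ℕ.+-monoʳ-< (∣ x ∣ % 2) lt ⟩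
  ∣ x ∣ % 2 + dimFace ys    ≡⟨ dimFace-∷ x ys ⟨
  dimFace (x ∷ ys)          ∎

⊆F⇒≡⊎dimFace< : ∀ {n} {g f : Center n} → g ⊆F f → g ≡ f ⊎ dimFace g ℕ.< dimFace f
⊆F⇒≡⊎dimFace< {g = []}    {[]}    _   = inj₁ refl
⊆F⇒≡⊎dimFace< {g = a ∷ g} {b ∷ f} g⊆f
  with ⊑⇒≡⊎odd×even (g⊆f zero) | ⊆F⇒≡⊎dimFace< {g = g} {f} (λ i → g⊆f (Fin.suc i))
... | inj₁ refl | inj₁ refl = inj₁ refl
... | inj₁ refl | inj₂ lt   = inj₂ (dimFace-∷-monoʳ-< a lt)
... | inj₂ (odd , even) | tail = inj₂ (begin-strict
  dimFace (a ∷ g)           ≡⟨ dimFace-∷ a g ⟩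
  ∣ a ∣ % 2 + dimFace g     ≡⟨ cong (_+ dimFace g) even ⟩
  dimFace g                 ≤⟨ tail≤ tail ⟩
  dimFace f                 <⟨ ℕ.n<1+n (dimFace f) ⟩
  1 + dimFace f             ≡⟨ cong (_+ dimFace f) odd ⟨
  ∣ b ∣ % 2 + dimFace f     ≡⟨ dimFace-∷ b f ⟨
  dimFace (b ∷ f)           ∎)
  where
  tail≤ : g ≡ f ⊎ dimFace g ℕ.< dimFace f → dimFace g ≤ dimFace f
  tail≤ (inj₁ refl) = ℕ.≤-refl
  tail≤ (inj₂ lt)   = ℕ.<⇒≤ lt

⊆F∧dimFace≡⇒≡ : ∀ {n} {g f : Center n} → g ⊆F f → dimFace g ≡ dimFace f → g ≡ f
⊆F∧dimFace≡⇒≡ g⊆f eq with ⊆F⇒≡⊎dimFace< g⊆f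
... | inj₁ g≡f = g≡f
... | inj₂ lt  = contradiction eq (ℕ.<⇒≢ lt)

≤lex⇒head≤ : ∀ {n} {f f' : Center (suc n)} → f ≤lex f' → lookup f zero ℤ.≤ lookup f' zero
≤lex⇒head≤ (inj₁ refl)                   = ℤ.≤-refl
≤lex⇒head≤ (inj₂ (zero , _ , lt))        = ℤ.<⇒≤ lt
≤lex⇒head≤ (inj₂ (Fin.suc _ , eqs , _)) = ℤ.≤-reflexive (eqs zero (s≤s z≤n))

facet-partner : ∀ {n k} {S : List (Center (suc n))} → All (IsFace k) S → Closed k S →
  ∀ {x xs} → (x ∷ xs) ∈ S → Odd x → ∀ {e} → Even e → e ⊑ x →
  ∃₂ λ y ys → (y ∷ ys) ∈ S × x ≢ y × e ⊑ y
facet-partner {k = k} faces closed {x} {xs} f∈S odd {e} even e⊑x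
  with closed (x ∷ xs) f∈S (e ∷ xs) facet-dim facet⊆f
  where
  facet-dim : dimFace (e ∷ xs) ≡ k ∸ 1
  facet-dim = begin-equality
    dimFace (e ∷ xs)                ≡⟨ dimFace-∷ e xs ⟩
    ∣ e ∣ % 2 + dimFace xs          ≡⟨ cong (_+ dimFace xs) even ⟩
    (1 + dimFace xs) ∸ 1            ≡⟨ cong (λ p → (p + dimFace xs) ∸ 1) odd ⟨
    (∣ x ∣ % 2 + dimFace xs) ∸ 1    ≡⟨ cong (_∸ 1) (dimFace-∷ x xs) ⟨
    dimFace (x ∷ xs) ∸ 1            ≡⟨ cong (_∸ 1) (All.lookup faces f∈S) ⟩
    k ∸ 1                           ∎
  facet⊆f : (e ∷ xs) ⊆F (x ∷ xs)
  facet⊆f zero        = e⊑x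
  facet⊆f (Fin.suc _) = inj₁ refl
... | y ∷ ys , f'∈S , f'≢f , facet⊆f' = y , ys , f'∈S , x≢y , facet⊆f' zero
  where
  x≢y : x ≢ y
  x≢y refl = f'≢f (cong (x ∷_) (sym (⊆F∧dimFace≡⇒≡ (λ i → facet⊆f' (Fin.suc i))
    (dimFace-∷-cancelˡ x (trans (All.lookup faces f∈S) (sym (All.lookup faces f'∈S)))))))

mainTheorem15 : ∀ (n k : ℕ) → 1 ≤ k → k ≤ suc n →
    ∀ (S : List (Center (suc n))) → S ≢ [] → All (IsFace k) S → Closed k S →
    (∀ f → IsLexMin S f → Even (lookup f zero))
    × (∀ f → IsLexMax S f → Even (lookup f zero))
mainTheorem15 _ _ _ _ S _ faces closed = min-even , max-even
  where
  min-even : ∀ f → IsLexMin S f → Even (lookup f zero)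
  min-even (x ∷ xs) (f∈S , minimal) with parity x
  ... | inj₂ even = even
  ... | inj₁ odd with facet-partner faces closed f∈S odd (odd⇒even[i-1] x odd) (inj₂ (odd , inj₂ refl))
  ... | y , ys , f'∈S , x≢y , x-1⊑y =
    contradiction (i-1⊑j∧i≤j⇒i≡j x-1⊑y (≤lex⇒head≤ (minimal (y ∷ ys) f'∈S))) x≢y
  max-even : ∀ f → IsLexMax S f → Even (lookup f zero)
  max-even (x ∷ xs) (f∈S , maximal) with parity x
  ... | inj₂ even = even
  ... | inj₁ odd with facet-partner faces closed f∈S odd (odd⇒even[i+1] x odd) (inj₂ (odd , inj₁ refl))
  ... | y , ys , f'∈S , x≢y , x+1⊑y =
    contradiction (i+1⊑j∧j≤i⇒i≡j x+1⊑y (≤lex⇒head≤ (maximal (y ∷ ys) f'∈S))) x≢y
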